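{- Let $n\ge 3$, let $A\in\mathscr S^*_s(n)$ have parameters $c=c(A)$, $v=v(A)$, $s=s(A)$, and suppose there exists $A_1\in\mathscr S^*(n)$ whose parameters $c_1=c(A_1)$, $v_1=v(A_1)$, $s_1=s(A_1)$ satisfy $c_1=c$, $v_1>v$ and $s_1\ge s$. Then $\phi(A)<\phi(A_1)$.
   Context: $\mathscr S(n)$ is the set of $n\times n$ $(0,1)$-matrices with zero diagonal. $\mathscr S^*(n)$ is the set of $A=(a_{ij})\in\mathscr S(n)$ with $a_{12}=a_{21}=1$, $a_{n-1,n}=a_{n,n-1}=0$, and such that whenever $a_{ij}=1$, also $a_{hk}=1$ for all $h\le i$, $k\le j$ with $h\neq k$. $\mathscr S^*_s(n)$ is the set of symmetric matrices in $\mathscr S^*(n)$. For $A\in\mathscr S^*(n)$ with row sums $r_1,\dots,r_n$: $c(A)=\max\{i\in[n]: r_1+\cdots+r_i>i(i-1)\}$, $v(A)=r_{c(A)+1}$, $s(A)=\sum_{i=1}^{c(A)}r_i-c(A)(c(A)-1)$, and $\phi(A)=\frac12\left(v-1+\sqrt{(2c-v-1)^2+4s}\right)$ with $c=c(A),v=v(A),s=s(A)$. -}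

module Defs where

open import Data.Bool using (Bool; true; false; if_then_else_)
open import Data.Nat as ℕ using (ℕ; zero; suc; _≤_; _<?_)
open import Data.Fin using (Fin; toℕ)
open import Data.List using (List; map; allFin)
open import Data.Nat.ListAction using (sum)
open import Data.Product using (_×_; ∃)
open import Data.Sum using (_⊎_)
open import Data.Integer as ℤ using (ℤ; +_)
open import Data.Rational as ℚ using (ℚ; _/_; 0ℚ)
open import Relation.Binary.PropositionalEquality using (_≡_; _≢_)
open import Relation.Nullary.Decidable using (does)

-- An n×n (0,1)-matrix: entry true = 1, false = 0.  Indices are 0-based
-- (Fin n), i.e. the paper's row i is the Fin element with toℕ = i - 1.
Mat : ℕ → Set
Mat n = Fin n → Fin n → Bool

ZeroDiag : ∀ {n} → Mat n → Set
ZeroDiag {n} A = ∀ (i : Fin n) → A i i ≡ false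

record InSStar (n : ℕ) (A : Mat n) : Set where
  field
    zeroDiag : ZeroDiag A
    a12 : ∀ (i j : Fin n) → toℕ i ≡ 0 → toℕ j ≡ 1 → A i j ≡ true
    a21 : ∀ (i j : Fin n) → toℕ i ≡ 1 → toℕ j ≡ 0 → A i j ≡ true
    -- a_{n-1,n} = a_{n,n-1} = 0
    aLast1 : ∀ (i j : Fin n) → suc (suc (toℕ i)) ≡ n → suc (toℕ j) ≡ n → A i j ≡ false
    aLast2 : ∀ (i j : Fin n) → suc (toℕ i) ≡ n → suc (suc (toℕ j)) ≡ n → A i j ≡ false
    closed : ∀ (i j h k : Fin n) → A i j ≡ true → toℕ h ≤ toℕ i → toℕ k ≤ toℕ j
             → h ≢ k → A h k ≡ true

Symmetric : ∀ {n} → Mat n → Set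
Symmetric {n} A = ∀ (i j : Fin n) → A i j ≡ A j i

InSStarSym : (n : ℕ) → Mat n → Set
InSStarSym n A = InSStar n A × Symmetric A

b2n : Bool → ℕ
b2n true = 1
b2n false = 0

rowSumF : ∀ {n} → Mat n → Fin n → ℕ
rowSumF {n} A i = sum (map (λ j → b2n (A i j)) (allFin n))

-- r_k for the paper's 1-based index k (0 if k ∉ [n])
r : ∀ {n} → Mat n → ℕ → ℕ
r {n} A k = sum (map (λ i → if does (suc (toℕ i) ℕ.≟ k) then rowSumF A i else 0) (allFin n))

prefixSum : ∀ {n} → Mat n → ℕ → ℕ
prefixSum {n} A k = sum (map (λ i → if does (suc (toℕ i) <? suc k) then rowSumF A i else 0) (allFin n))

-- largest i ≤ m, i ≥ 1, with r_1+⋯+r_i > i(i-1); 0 if none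
maxSat : ∀ {n} → Mat n → ℕ → ℕ
maxSat A zero = zero
maxSat A (suc i) =
  if does (suc i ℕ.* i <? prefixSum A (suc i)) then suc i else maxSat A i

cA : ∀ {n} → Mat n → ℕ
cA {n} A = maxSat A n

vA : ∀ {n} → Mat n → ℕ
vA A = r A (suc (cA A))

sA : ∀ {n} → Mat n → ℤ
sA A = + prefixSum A (cA A) ℤ.- + (cA A ℕ.* (cA A ℕ.∸ 1))

-- φ(A) = (p + √X)/2 with p = v - 1, X = (2c - v - 1)² + 4s
phiP : ∀ {n} → Mat n → ℤ
phiP A = + vA A ℤ.- + 1

phiX : ∀ {n} → Mat n → ℤ
phiX A = let d = + (2 ℕ.* cA A) ℤ.- + vA A ℤ.- + 1 in d ℤ.* d ℤ.+ + 4 ℤ.* sA A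

toℚ : ℤ → ℚ
toℚ z = z / 1

-- Order between the real (p + √X)/2 (X ≥ 0) and a rational q, via the
-- Dedekind cut of √X.  With t = 2q - p:
-- (p + √X)/2 < q  ⇔  √X < t  ⇔  0 < t ∧ X < t²
SurdBelow : ℤ → ℤ → ℚ → Set
SurdBelow p X q = let t = + 2 / 1 ℚ.* q ℚ.- toℚ p in (0ℚ ℚ.< t) × (toℚ X ℚ.< t ℚ.* t)

-- q < (p + √X)/2  ⇔  t < √X  ⇔  t < 0 ∨ t² < X
SurdAbove : ℤ → ℤ → ℚ → Set
SurdAbove p X q = let t = + 2 / 1 ℚ.* q ℚ.- toℚ p in (t ℚ.< 0ℚ) ⊎ (t ℚ.* t ℚ.< toℚ X)

-- φ(A) < φ(B) as reals: some rational lies strictly between them.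
PhiLt : ∀ {n} → Mat n → Mat n → Set
PhiLt A B = ∃ λ (q : ℚ) → SurdBelow (phiP A) (phiX A) q × SurdAbove (phiP B) (phiX B) q

-- With p = v - 1, d = 2c - v - 1 and X = d² + 4s we have φ = (p + √X)/2.
-- Passing from A to A₁ raises p by e = v₁ - v ≥ 1, lowers d by e and does
-- not decrease s, so it suffices that √(d² + 4s) - e < √((d - e)² + 4s₁).
-- This holds because d ↦ √(d² + 4s) has slope of absolute value < 1 once
-- s > 0, and s(A) > 0 because a₁₂ = 1 forces c(A) ≥ 1.
--
-- The order on surds is given by rational cuts, so the separation has to be
-- witnessed by a rational t = a/N slightly above √X: with N = X and
-- a = ⌊√(N³)⌋ + 1 one gets √X < t, d < t and (t - 1)² < (d - 1)² + 4s, and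
-- the last inequality propagates to (t - e)² < (d - e)² + 4s₁ for all e ≥ 1,
-- s₁ ≥ s.  Then q = (t + p)/2 lies strictly between φ(A) and φ(A₁).
{-# OPTIONS --safe #-}
module Submission where

open import Defs

module NatSqrt where
  open import Data.Nat
  open import Data.Nat.Properties
  open import Data.Nat.Tactic.RingSolver using (solve-∀)
  open import Data.Product using (∃-syntax; _×_; _,_)
  open import Relation.Binary.PropositionalEquality using (_≡_; sym; subst; cong)
  open import Relation.Nullary using (yes; no)

  -- Opaque, so that type checking the callers (whose n is always a
  -- successor) does not unfold the search.
  opaque
    integer-sqrt : ∀ n → ∃[ b ] b * b ≤ n × n < suc b * suc b
    integer-sqrt zero = 0 , z≤n , s≤s z≤n
    integer-sqrt (suc n) with integer-sqrt n
    ... | b , b²≤n , n<[1+b]² with suc n <? suc b * suc b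
    ...   | yes 1+n<[1+b]² = b , m≤n⇒m≤1+n b²≤n , 1+n<[1+b]²
    ...   | no  1+n≮[1+b]² =
      suc b , ≮⇒≥ 1+n≮[1+b]² , ≤-<-trans n<[1+b]² (*-mono-< (n<1+n (suc b)) (n<1+n (suc b)))

  m*m≤n⇒[1+m]*[1+m]<n+2*[1+m] : ∀ {m n} → m * m ≤ n → suc m * suc m < n + 2 * suc m
  m*m≤n⇒[1+m]*[1+m]<n+2*[1+m] {m} {n} m²≤n =
    subst (_≤ n + 2 * suc m) (sym (expand m)) (+-monoˡ-≤ (2 * suc m) m²≤n)
    where
    expand : ∀ m → suc (suc m * suc m) ≡ m * m + 2 * suc m
    expand = solve-∀

  m*m≤n*n⇒m≤n : ∀ {m n} → m * m ≤ n * n → m ≤ n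
  m*m≤n*n⇒m≤n m²≤n² = ≮⇒≥ (λ n<m → <⇒≱ (*-mono-< n<m n<m) m²≤n²)

  m<n⇒m*[1+n]≤n*n : ∀ {m n} → m < n → m * suc n ≤ n * n
  m<n⇒m*[1+n]≤n*n {m} {n} m<n = begin
    m * suc n  ≡⟨ *-suc m n ⟩
    m + m * n  ≤⟨ +-monoˡ-≤ (m * n) (<⇒≤ m<n) ⟩
    suc m * n  ≤⟨ *-monoˡ-≤ n m<n ⟩
    n * n      ∎
    where open ≤-Reasoning

  module _ (D K : ℕ) (D²<K : D * D < K) where
    private
      N : ℕ
      N = suc K

    numerator-bound : ∀ {A} → N * (N * N) < A * A → D * (N * N) ≤ K * A
    numerator-bound {A} N³<A² = m*m≤n*n⇒m≤n (begin
      D * (N * N) * (D * (N * N))  ≡⟨ regroup D N ⟩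
      D * D * N * (N * (N * N))    ≤⟨ *-mono-≤ (m<n⇒m*[1+n]≤n*n D²<K) (<⇒≤ N³<A²) ⟩
      K * K * (A * A)              ≡⟨ regroup′ K A ⟩
      K * A * (K * A)              ∎)
      where
      open ≤-Reasoning
      regroup : ∀ D N → D * (N * N) * (D * (N * N)) ≡ D * D * N * (N * (N * N))
      regroup = solve-∀
      regroup′ : ∀ K A → K * K * (A * A) ≡ K * A * (K * A)
      regroup′ = solve-∀

    sqrt-overestimate : ∃[ b ] let A = suc b in
      N * (N * N) < A * A × A * A + 2 * D * (N * N) < N * (N * N) + 2 * N * A × D * N < A
    sqrt-overestimate with integer-sqrt (N * (N * N))
    ... | b , b²≤N³ , N³<A² = b , N³<A² , near , DN<A
      where
      A : ℕ
      A = suc b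
      DN²≤KA : D * (N * N) ≤ K * A
      DN²≤KA = numerator-bound N³<A²
      near : A * A + 2 * D * (N * N) < N * (N * N) + 2 * N * A
      near = begin-strict
        A * A + 2 * D * (N * N)            ≡⟨ cong (A * A +_) (*-assoc 2 D (N * N)) ⟩
        A * A + 2 * (D * (N * N))          <⟨ +-mono-<-≤ (m*m≤n⇒[1+m]*[1+m]<n+2*[1+m] b²≤N³)
                                                          (*-monoʳ-≤ 2 DN²≤KA) ⟩
        N * (N * N) + 2 * A + 2 * (K * A)  ≡⟨ collect (N * (N * N)) K A ⟩
        N * (N * N) + 2 * N * A            ∎
        where
        open ≤-Reasoning
        collect : ∀ M K A → M + 2 * A + 2 * (K * A) ≡ M + 2 * suc K * A
        collect = solve-∀
      DN<A : D * N < A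
      DN<A = *-cancelʳ-< N (D * N) A (begin-strict
        D * N * N    ≡⟨ *-assoc D N N ⟩
        D * (N * N)  ≤⟨ DN²≤KA ⟩
        K * A        <⟨ m<n+m (K * A) z<s ⟩
        N * A        ≡⟨ *-comm N A ⟩
        A * N        ∎)
        where open ≤-Reasoning

module RationalCuts where
  open import Data.Nat as ℕ using (ℕ; suc)
  import Data.Nat.Properties as ℕ
  open import Data.Integer as ℤ using (ℤ; +_)
  import Data.Integer.Properties as ℤ
  open import Data.Integer.Tactic.RingSolver using (solve-∀)
  open import Data.Rational as ℚ using (ℚ; 0ℚ; ½; _/_; toℚᵘ; fromℚᵘ)
  open import Data.Rational.Properties
    using (toℚᵘ-homo-+; toℚᵘ-homo-*; toℚᵘ-homo‿-; toℚᵘ-fromℚᵘ; toℚᵘ-cancel-<)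
  open import Data.Rational.Solver using (module +-*-Solver)
  open import Data.Rational.Unnormalised as ℚᵘ using (ℚᵘ; mkℚᵘ; _≃_; *≡*; *<*)
  open import Data.Rational.Unnormalised.Properties
    using (≃-refl; ≃-sym; ≃-trans; +-cong; +-congʳ; -‿cong; *-cong; <-respˡ-≃; <-respʳ-≃)
  open import Data.Product using (∃; _×_; _,_)
  open import Data.Sum using (inj₂)
  open import Relation.Binary.PropositionalEquality using (_≡_; refl; sym; subst)

  offset : ℤ → ℚ → ℚ
  offset p q = + 2 / 1 ℚ.* q ℚ.- toℚ p

  midpoint : ℤ → ℚ → ℚ
  midpoint p t = (t ℚ.+ toℚ p) ℚ.* ½

  offset-midpoint : ∀ p p′ t → offset p′ (midpoint p t) ≡ t ℚ.- (toℚ p′ ℚ.- toℚ p)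
  offset-midpoint p p′ t =
    solve 3 (λ t x y → con (+ 2 / 1) :* ((t :+ x) :* con ½) :- y := t :- (y :- x))
            refl t (toℚ p) (toℚ p′)
    where open +-*-Solver

  offset-midpoint-self : ∀ p t → offset p (midpoint p t) ≡ t
  offset-midpoint-self p t =
    solve 2 (λ t x → con (+ 2 / 1) :* ((t :+ x) :* con ½) :- x := t) refl t (toℚ p)
    where open +-*-Solver

  toℚᵘ-toℚ : ∀ i → toℚᵘ (toℚ i) ≃ mkℚᵘ i 0
  toℚᵘ-toℚ i = toℚᵘ-fromℚᵘ (mkℚᵘ i 0)

  toℚᵘ-homo-− : ∀ x y → toℚᵘ (x ℚ.- y) ≃ toℚᵘ x ℚᵘ.- toℚᵘ y
  toℚᵘ-homo-− x y = ≃-trans (toℚᵘ-homo-+ x (ℚ.- y)) (+-congʳ (toℚᵘ x) (toℚᵘ-homo‿- y))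

  toℚᵘ-square : ∀ {x x′} → toℚᵘ x ≃ x′ → toℚᵘ (x ℚ.* x) ≃ x′ ℚᵘ.* x′
  toℚᵘ-square {x} x≃x′ = ≃-trans (toℚᵘ-homo-* x x) (*-cong x≃x′ x≃x′)

  <-via-toℚᵘ : ∀ {x y x′ y′} → toℚᵘ x ≃ x′ → toℚᵘ y ≃ y′ → x′ ℚᵘ.< y′ → x ℚ.< y
  <-via-toℚᵘ x≃x′ y≃y′ x′<y′ =
    toℚᵘ-cancel-< (<-respˡ-≃ (≃-sym x≃x′) (<-respʳ-≃ (≃-sym y≃y′) x′<y′))

  toℚᵘ-toℚ-minus : ∀ i j → toℚᵘ (toℚ i ℚ.- toℚ j) ≃ mkℚᵘ (i ℤ.- j) 0
  toℚᵘ-toℚ-minus i j = ≃-trans (toℚᵘ-homo-− (toℚ i) (toℚ j))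
    (≃-trans (+-cong (toℚᵘ-toℚ i) (-‿cong (toℚᵘ-toℚ j))) (*≡* (identity i j)))
    where
    identity : ∀ i j → (i ℤ.* + 1 ℤ.+ ℤ.- j ℤ.* + 1) ℤ.* + 1 ≡ (i ℤ.- j) ℤ.* + 1
    identity = solve-∀

  fraction-minus : ∀ a m k → mkℚᵘ a m ℚᵘ.- mkℚᵘ k 0 ≃ mkℚᵘ (a ℤ.- k ℤ.* + suc m) m
  fraction-minus a m k = *≡* (subst (λ n → (a ℤ.* + 1 ℤ.+ ℤ.- k ℤ.* + suc m) ℤ.* + suc m
                                             ≡ (a ℤ.- k ℤ.* + suc m) ℤ.* + suc n)
                                    (sym (ℕ.*-identityʳ m)) (identity a k (+ suc m)))
    where
    identity : ∀ a k N → (a ℤ.* + 1 ℤ.+ ℤ.- k ℤ.* N) ℤ.* N ≡ (a ℤ.- k ℤ.* N) ℤ.* N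
    identity = solve-∀

  module _ {b : ℤ} {m : ℕ} where
    private
      N : ℤ
      N = + suc m

    0<fraction : + 0 ℤ.< b → ℚᵘ.0ℚᵘ ℚᵘ.< mkℚᵘ b m
    0<fraction 0<b = *<* (subst (+ 0 ℤ.<_) (sym (ℤ.*-identityʳ b)) 0<b)

    integer<fraction² : ∀ {X} → X ℤ.* (N ℤ.* N) ℤ.< b ℤ.* b →
                        mkℚᵘ X 0 ℚᵘ.< mkℚᵘ b m ℚᵘ.* mkℚᵘ b m
    integer<fraction² {X} XN²<b² =
      *<* (subst (X ℤ.* (N ℤ.* N) ℤ.<_) (sym (ℤ.*-identityʳ (b ℤ.* b))) XN²<b²)

    fraction²<integer : ∀ {X} → b ℤ.* b ℤ.< X ℤ.* (N ℤ.* N) →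
                        mkℚᵘ b m ℚᵘ.* mkℚᵘ b m ℚᵘ.< mkℚᵘ X 0
    fraction²<integer {X} b²<XN² =
      *<* (subst (ℤ._< X ℤ.* (N ℤ.* N)) (sym (ℤ.*-identityʳ (b ℤ.* b))) b²<XN²)

  separating-rational : ∀ p p′ X X′ a m → let N = + suc m ; a′ = a ℤ.- (p′ ℤ.- p) ℤ.* N in
    + 0 ℤ.< a → X ℤ.* (N ℤ.* N) ℤ.< a ℤ.* a → a′ ℤ.* a′ ℤ.< X′ ℤ.* (N ℤ.* N) →
    ∃ λ q → SurdBelow p X q × SurdAbove p′ X′ q
  separating-rational p p′ X X′ a m 0<a XN²<a² a′²<X′N² = midpoint p t , below , inj₂ above
    where
    τ : ℚᵘ
    τ = mkℚᵘ a m
    t : ℚ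
    t = fromℚᵘ τ
    t≃τ : toℚᵘ t ≃ τ
    t≃τ = toℚᵘ-fromℚᵘ τ
    below : SurdBelow p X (midpoint p t)
    below = subst (λ u → 0ℚ ℚ.< u × toℚ X ℚ.< u ℚ.* u) (sym (offset-midpoint-self p t))
              ( <-via-toℚᵘ ≃-refl t≃τ (0<fraction {a} {m} 0<a)
              , <-via-toℚᵘ (toℚᵘ-toℚ X) (toℚᵘ-square t≃τ) (integer<fraction² {a} {m} XN²<a²))
    t′≃a′/N : toℚᵘ (t ℚ.- (toℚ p′ ℚ.- toℚ p)) ≃ mkℚᵘ (a ℤ.- (p′ ℤ.- p) ℤ.* + suc m) m
    t′≃a′/N = ≃-trans (toℚᵘ-homo-− t _)
      (≃-trans (+-cong t≃τ (-‿cong (toℚᵘ-toℚ-minus p′ p))) (fraction-minus a m (p′ ℤ.- p)))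
    above : offset p′ (midpoint p t) ℚ.* offset p′ (midpoint p t) ℚ.< toℚ X′
    above = subst (λ u → u ℚ.* u ℚ.< toℚ X′) (sym (offset-midpoint p p′ t))
              (<-via-toℚᵘ (toℚᵘ-square t′≃a′/N) (toℚᵘ-toℚ X′)
                (fraction²<integer {a ℤ.- (p′ ℤ.- p) ℤ.* + suc m} {m} a′²<X′N²))

module SurdComparison where
  open import Data.Nat as ℕ using (ℕ; suc; z≤n; z<s)
  import Data.Nat.Properties as ℕ
  import Data.Nat.Tactic.RingSolver as ℕ
  open import Data.Integer hiding (suc)
  open import Data.Integer.Properties
  open import Data.Integer.Tactic.RingSolver using (solve-∀)
  open import Data.Product using (∃; ∃₂; _×_; _,_)
  open import Relation.Binary.PropositionalEquality using (_≡_; refl; sym; trans; subst; subst₂; cong)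
  open NatSqrt using (sqrt-overestimate)
  open RationalCuts using (separating-rational)

  i≤+∣i∣ : ∀ i → i ≤ + ∣ i ∣
  i≤+∣i∣ (+ n)    = ≤-refl
  i≤+∣i∣ -[1+ n ] = -≤+

  +∣i∣*∣i∣≡i*i : ∀ i → + (∣ i ∣ ℕ.* ∣ i ∣) ≡ i * i
  +∣i∣*∣i∣≡i*i (+ n)    = pos-* n n
  +∣i∣*∣i∣≡i*i -[1+ n ] = refl

  0≤i⇒0≤j⇒0≤i*j : ∀ {i j} → + 0 ≤ i → + 0 ≤ j → + 0 ≤ i * j
  0≤i⇒0≤j⇒0≤i*j {+ m} {+ n} _ _ = subst (+ 0 ≤_) (pos-* m n) (+≤+ z≤n)

  i<j⇒0<j-i : ∀ {i j} → i < j → + 0 < j - i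
  i<j⇒0<j-i {i} {j} i<j = subst (_< j - i) (+-inverseʳ i) (+-monoˡ-< (- i) i<j)

  0<j-i⇒i<j : ∀ {i j} → + 0 < j - i → i < j
  0<j-i⇒i<j {i} {j} 0<j-i = subst₂ _<_ (+-identityʳ i) (i+[j-i]≡j i j) (+-monoʳ-< i 0<j-i)
    where
    i+[j-i]≡j : ∀ i j → i + (j - i) ≡ j
    i+[j-i]≡j = solve-∀

  m<n⇒1≤n-m : ∀ {m n} → m ℕ.< n → + 1 ≤ + n - + m
  m<n⇒1≤n-m {m} {n} m<n = subst (_≤ + n - + m) (1+m-m≡1 (+ m)) (+-monoˡ-≤ (- + m) (+≤+ m<n))
    where
    1+m-m≡1 : ∀ m → + 1 + m - m ≡ + 1
    1+m-m≡1 = solve-∀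

  module _ (d : ℤ) (K b : ℕ) where
    private
      D : ℕ
      D = ∣ d ∣
      N a : ℤ
      N = + suc K
      a = + suc b

    lift-near : suc b ℕ.* suc b ℕ.+ 2 ℕ.* D ℕ.* (suc K ℕ.* suc K)
                  ℕ.< suc K ℕ.* (suc K ℕ.* suc K) ℕ.+ 2 ℕ.* suc K ℕ.* suc b →
                a * a + + 2 * d * (N * N) < N * (N * N) + + 2 * N * a
    lift-near near = begin-strict
      a * a + + 2 * d * (N * N)    ≤⟨ +-monoʳ-≤ (a * a) (*-monoʳ-≤-nonNeg (N * N)
                                        (*-monoˡ-≤-nonNeg (+ 2) (i≤+∣i∣ d))) ⟩
      a * a + + 2 * + D * (N * N)  ≡⟨ cong (λ u → a * a + u)
                                        (sym (trans (pos-* (2 ℕ.* D) _) (cong (_* (N * N)) (pos-* 2 D)))) ⟩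
      + (suc b ℕ.* suc b ℕ.+ 2 ℕ.* D ℕ.* (suc K ℕ.* suc K))  <⟨ +<+ near ⟩
      N * (N * N) + + 2 * N * a    ∎
      where open ≤-Reasoning

    lift-dN≤a : D ℕ.* suc K ℕ.< suc b → d * N ≤ a
    lift-dN≤a DN<A = begin
      d * N            ≤⟨ *-monoʳ-≤-nonNeg N (i≤+∣i∣ d) ⟩
      + D * N          ≡⟨ sym (pos-* D (suc K)) ⟩
      + (D ℕ.* suc K)  ≤⟨ +≤+ (ℕ.<⇒≤ DN<A) ⟩
      a                ∎
      where open ≤-Reasoning

  sqrt-overestimateℤ : ∀ d S → let X = d * d + + 4 * + suc S in
    ∃₂ λ a m → let N = + suc m in
      + 0 < a × X * (N * N) < a * a × a * a + + 2 * d * (N * N) < X * (N * N) + + 2 * N * a × d * N ≤ a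
  sqrt-overestimateℤ d S =
    let b , N³<A² , near , DN<A = sqrt-overestimate D K (ℕ.m<m+n (D ℕ.* D) z<s)
        a = + suc b
    in a , K , +<+ z<s
     , subst (λ X → X * (N * N) < a * a) (sym X≡N) (+<+ N³<A²)
     , subst (λ X → a * a + + 2 * d * (N * N) < X * (N * N) + + 2 * N * a) (sym X≡N) (lift-near d K b near)
     , lift-dN≤a d K b DN<A
    where
    D K : ℕ
    D = ∣ d ∣
    K = D ℕ.* D ℕ.+ (3 ℕ.+ 4 ℕ.* S)
    N : ℤ
    N = + suc K
    X≡N : d * d + + 4 * + suc S ≡ N
    X≡N = trans (cong (_+ + 4 * + suc S) (sym (+∣i∣*∣i∣≡i*i d)))
                (cong +_ (rearrange (D ℕ.* D) S))
      where
      rearrange : ∀ x S → x ℕ.+ 4 ℕ.* suc S ≡ suc (x ℕ.+ (3 ℕ.+ 4 ℕ.* S))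
      rearrange = ℕ.solve-∀

  -- With t = a/N the hypothesis reads (t - 1)² < (d - 1)² + 4s, and passing
  -- to (e, s₁) increases the gap by 4(s₁ - s) + 2(e - 1)(t - d) ≥ 0.
  below-shifted-sqrt : ∀ {a N d s s₁ e} → + 0 ≤ N → d * N ≤ a → s ≤ s₁ → + 1 ≤ e →
    a * a + + 2 * d * (N * N) < (d * d + + 4 * s) * (N * N) + + 2 * N * a →
    (a - e * N) * (a - e * N) < ((d - e) * (d - e) + + 4 * s₁) * (N * N)
  below-shifted-sqrt {a} {N} {d} {s} {s₁} {e} 0≤N dN≤a s≤s₁ 1≤e near =
    0<j-i⇒i<j (subst (+ 0 <_) (sym (split a N d s s₁ e))
      (+-mono-<-≤ (i<j⇒0<j-i near) (+-mono-≤ s-term e-term)))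
    where
    s-term : + 0 ≤ + 4 * (s₁ - s) * (N * N)
    s-term = 0≤i⇒0≤j⇒0≤i*j (0≤i⇒0≤j⇒0≤i*j {+ 4} (+≤+ z≤n) (i≤j⇒0≤j-i s≤s₁))
                           (0≤i⇒0≤j⇒0≤i*j 0≤N 0≤N)
    e-term : + 0 ≤ + 2 * (e - + 1) * (N * (a - d * N))
    e-term = 0≤i⇒0≤j⇒0≤i*j (0≤i⇒0≤j⇒0≤i*j {+ 2} (+≤+ z≤n) (i≤j⇒0≤j-i 1≤e))
                           (0≤i⇒0≤j⇒0≤i*j 0≤N (i≤j⇒0≤j-i dN≤a))
    split : ∀ a N d s s₁ e →
      ((d - e) * (d - e) + + 4 * s₁) * (N * N) - (a - e * N) * (a - e * N)
        ≡ (((d * d + + 4 * s) * (N * N) + + 2 * N * a) - (a * a + + 2 * d * (N * N)))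
          + (+ 4 * (s₁ - s) * (N * N) + + 2 * (e - + 1) * (N * (a - d * N)))
    split = solve-∀

  surd-gap : ∀ p p′ d s s₁ → + 0 < s → s ≤ s₁ → + 1 ≤ p′ - p →
    ∃ λ q → SurdBelow p (d * d + + 4 * s) q
          × SurdAbove p′ ((d - (p′ - p)) * (d - (p′ - p)) + + 4 * s₁) q
  surd-gap p p′ d (+ 0)     s₁ (+<+ ())
  surd-gap p p′ d (+ suc S) s₁ _ s≤s₁ 1≤p′-p =
    let a , m , 0<a , XN²<a² , near , dN≤a = sqrt-overestimateℤ d S
    in separating-rational p p′ (d * d + + 4 * + suc S) ((d - (p′ - p)) * (d - (p′ - p)) + + 4 * s₁)
         a m 0<a XN²<a²
         (below-shifted-sqrt {d = d} {s = + suc S} (+≤+ z≤n) dN≤a s≤s₁ 1≤p′-p near)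

  radicand : ℕ → ℕ → ℤ → ℤ
  radicand c v s = let d = + (2 ℕ.* c) - + v - + 1 in d * d + + 4 * s

  φ-increasing : ∀ c v v₁ s s₁ → + 0 < s → s ≤ s₁ → v ℕ.< v₁ →
    ∃ λ q → SurdBelow (+ v - + 1) (radicand c v s) q
          × SurdAbove (+ v₁ - + 1) (radicand c v₁ s₁) q
  φ-increasing c v v₁ s s₁ 0<s s≤s₁ v<v₁ =
    subst (λ d₁ → ∃ λ q → SurdBelow p (d * d + + 4 * s) q
                        × SurdAbove p₁ (d₁ * d₁ + + 4 * s₁) q)
          (shift (+ (2 ℕ.* c)) (+ v) (+ v₁))
          (surd-gap p p₁ d s s₁ 0<s s≤s₁ 1≤p₁-p)
    where
    p p₁ d : ℤ
    p = + v - + 1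
    p₁ = + v₁ - + 1
    d = + (2 ℕ.* c) - + v - + 1
    shift : ∀ C x y → C - x - + 1 - ((y - + 1) - (x - + 1)) ≡ C - y - + 1
    shift = solve-∀
    difference : ∀ x y → y - x ≡ (y - + 1) - (x - + 1)
    difference = solve-∀
    1≤p₁-p : + 1 ≤ p₁ - p
    1≤p₁-p = subst (+ 1 ≤_) (difference (+ v) (+ v₁)) (m<n⇒1≤n-m v<v₁)

open import Data.Nat using (ℕ; zero; suc; _≤_; _<_; _*_; _∸_; _<?_; s≤s; z≤n)
open import Data.Nat.Properties using (≤-trans; <⇒≤; m≤m+n; m≤n⇒m≤o+n)
open import Data.Integer as ℤ using (+_; +<+)
open import Data.Bool using (if_then_else_)
open import Data.Fin using (Fin; zero; suc; toℕ)
open import Data.List using (_∷_; map; allFin)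
open import Data.List.Membership.Propositional using (_∈_)
open import Data.List.Membership.Propositional.Properties using (∈-map⁺; ∈-allFin)
open import Data.List.Relation.Unary.Any using (here; there)
open import Data.Nat.ListAction using (sum)
open import Data.Product using (∃; _×_; _,_)
open import Function using (id)
open import Relation.Nullary using (Dec; yes; no; ¬_; contradiction)
open import Relation.Nullary.Decidable using (does)
open import Relation.Binary.PropositionalEquality using (_≡_; refl; sym; subst)
open SurdComparison using (i<j⇒0<j-i; radicand; φ-increasing)

∈⇒≤sum : ∀ {m ns} → m ∈ ns → m ≤ sum ns
∈⇒≤sum {ns = n ∷ ns} (here refl)  = m≤m+n n (sum ns)
∈⇒≤sum {ns = n ∷ ns} (there m∈ns) = m≤n⇒m≤o+n n (∈⇒≤sum m∈ns)

≤-sum-allFin : ∀ {n} (f : Fin n → ℕ) i → f i ≤ sum (map f (allFin n))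
≤-sum-allFin f i = ∈⇒≤sum (∈-map⁺ f (∈-allFin i))

prefixSum-1-pos : ∀ {n} (A : Mat (suc (suc n))) → InSStar _ A → 0 < prefixSum A 1
prefixSum-1-pos A A∈𝒮* =
  ≤-trans a₁₂≤r₁ (≤-sum-allFin (λ i → if does (suc (toℕ i) <? 2) then rowSumF A i else 0) zero)
  where
  a₁₂≤r₁ : 1 ≤ rowSumF A zero
  a₁₂≤r₁ = subst (λ x → b2n x ≤ rowSumF A zero) (InSStar.a12 A∈𝒮* zero (suc zero) refl refl)
                 (≤-sum-allFin (λ j → b2n (A zero j)) (suc zero))

Exceeds : ∀ {n} → Mat n → ℕ → Set
Exceeds A i = i * (i ∸ 1) < prefixSum A i

if-preserves : ∀ {a b} {Q : Set a} (P : ℕ → Set b) (q? : Dec Q) {i j} →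
               (Q → P i) → (¬ Q → P j) → P (if does q? then i else j)
if-preserves P (yes q) onYes onNo = onYes q
if-preserves P (no ¬q) onYes onNo = onNo ¬q

maxSat-exceeds : ∀ {n} (A : Mat n) m → Exceeds A 1 → Exceeds A (maxSat A (suc m))
maxSat-exceeds A zero    h = if-preserves (Exceeds A) (_ <? _) id (contradiction h)
maxSat-exceeds A (suc m) h = if-preserves (Exceeds A) (_ <? _) id (λ _ → maxSat-exceeds A m h)

s-positive : ∀ {n} (A : Mat n) → 2 ≤ n → InSStar n A → + 0 ℤ.< sA A
s-positive {suc (suc n)} A (s≤s (s≤s z≤n)) A∈𝒮* =
  i<j⇒0<j-i (+<+ (maxSat-exceeds A (suc n) (prefixSum-1-pos A A∈𝒮*)))

proposition3p2 : (n : ℕ) → 3 ≤ n → (A A₁ : Mat n) → InSStarSym n A → InSStar n A₁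
    → cA A₁ ≡ cA A → vA A < vA A₁ → sA A ℤ.≤ sA A₁
    → PhiLt A A₁
proposition3p2 n 3≤n A A₁ (A∈𝒮* , _) _ c₁≡c v<v₁ s≤s₁ =
  subst (λ c → ∃ λ q → SurdBelow (phiP A) (phiX A) q
                     × SurdAbove (phiP A₁) (radicand c (vA A₁) (sA A₁)) q)
        (sym c₁≡c)
        (φ-increasing (cA A) (vA A) (vA A₁) (sA A) (sA A₁) 0<s s≤s₁ v<v₁)
  where
  0<s : + 0 ℤ.< sA A
  0<s = s-positive A (<⇒≤ 3≤n) A∈𝒮*
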